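{- Let $q=2^k t+1$ be a prime power, where $k>1$ is an integer and $t>1$ is an odd integer. Then there exists $\beta\in NQR(q)$ such that $(\beta+1)(\beta-1)\in NQR(q)$.
   Context: $QR(q)$ denotes the set of nonzero squares in $\mathbb{F}_q^*$ and $NQR(q)=\mathbb{F}_q^*\setminus QR(q)$ the set of non-squares. -}

module Defs where

open import Level using (Level; _⊔_)
open import Algebra.Bundles using (CommutativeRing)
open import Data.Nat using (ℕ; _^_; _≤_)
open import Data.Nat.Primality using (Prime)
open import Data.Fin using (Fin)
open import Data.Product using (Σ; ∃; _×_)
open import Relation.Binary.PropositionalEquality using (_≡_)
open import Relation.Nullary using (¬_)

IsPrimePower : ℕ → Set
IsPrimePower q = Σ ℕ λ p → Σ ℕ λ e → Prime p × 1 ≤ e × q ≡ p ^ e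

module _ {c ℓ : Level} (F : CommutativeRing c ℓ) where
  open CommutativeRing F

  record IsField : Set (c ⊔ ℓ) where
    field
      0≉1     : ¬ (0# ≈ 1#)
      inverse : ∀ x → ¬ (x ≈ 0#) → ∃ λ y → x * y ≈ 1#

  record HasCardinality (q : ℕ) : Set (c ⊔ ℓ) where
    field
      to        : Carrier → Fin q
      from      : Fin q → Carrier
      to-cong   : ∀ {x y} → x ≈ y → to x ≡ to y
      to-from   : ∀ i → to (from i) ≡ i
      from-to   : ∀ x → from (to x) ≈ x

  QR : Carrier → Set (c ⊔ ℓ)
  QR x = ¬ (x ≈ 0#) × ∃ λ y → y * y ≈ x

  NQR : Carrier → Set (c ⊔ ℓ)
  NQR x = ¬ (x ≈ 0#) × ¬ (QR x)

module Submission where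

-- Let F be a field with q = 4w + 1 elements. Summing
--     𝟙_A(x)·x over x and over x + 1 shows that a set A closed under x ↦ x ± 1 has #A = 0 in F;
--     for A = F this gives q = 0 in F, so no m with q = k·m + 1 vanishes in F (e.g. 2 and w).
--   * As 2 ≠ 0, every nonzero residue has exactly two square roots, so #QR = #NQR = 2w; then
--     multiplication by a nonresidue maps QR onto NQR, i.e. NQR·NQR ⊆ QR.
--   * Split NQR by whether x + 1 is a residue, a nonresidue or 0. Inversion swaps the first two
--     classes, so 2w = 2·#{x ∈ NQR : x + 1 ∈ NQR} + #{x ∈ NQR : x = -1}. By parity -1 ∈ QR and
--     exactly w nonresidues x have x + 1 ∈ NQR.
--   * If no β existed, this set of w elements would be closed under x ↦ x ± 1, so w = 0 in F,
--     contradicting q = 4w + 1.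

open import Defs
open import Level using (Level)
open import Algebra.Bundles using (CommutativeRing)
open import Data.Nat using (ℕ; _+_; _*_; _^_; _<_)
open import Data.Product using (Σ; ∃; _×_)
open import Relation.Binary.PropositionalEquality using (_≡_)

open import Level using (_⊔_)
open import Algebra.Bundles using (CommutativeMonoid)
import Algebra.Properties.CommutativeMonoid.Sum as MonoidSum
import Algebra.Properties.Ring as RingProperties
import Algebra.Properties.Semiring.Mult as SemiringMult
import Algebra.Solver.CommutativeMonoid as CommutativeMonoidSolver
import Relation.Binary.Reasoning.Setoid as SetoidReasoning
open import Data.Nat using (zero; suc; _≤_; z≤n; s≤s)
import Data.Nat.Properties as ℕₚ
open import Data.Nat.Tactic.RingSolver using (solve-∀)
open import Data.Fin using (Fin)
import Data.Fin.Properties as Finₚ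
import Data.Fin.Permutation as FinPermutation
open import Data.Product using (_,_; proj₁; proj₂)
open import Data.Sum using (_⊎_; inj₁; inj₂; [_,_]′)
open import Data.Empty using (⊥; ⊥-elim)
open import Data.Unit using (⊤; tt)
open import Relation.Nullary using (¬_; Dec; yes; no; ¬?; _×-dec_; _⊎-dec_)
open import Relation.Nullary.Decidable using (toSum)
open import Relation.Unary using (Decidable)
open import Relation.Binary using (_Respects_)
import Relation.Binary.PropositionalEquality as ≡
open import Relation.Binary.PropositionalEquality using (_≢_)

private variable
  a b d : Level
  P : Set a
  Q : Set b
  R : Set d

𝟙 : Dec P → ℕ
𝟙 (yes _) = 1
𝟙 (no _)  = 0

𝟙-yes : P → (dP : Dec P) → 𝟙 dP ≡ 1
𝟙-yes p (yes _) = ≡.refl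
𝟙-yes p (no ¬p) = ⊥-elim (¬p p)

𝟙-no : ¬ P → (dP : Dec P) → 𝟙 dP ≡ 0
𝟙-no ¬p (yes p) = ⊥-elim (¬p p)
𝟙-no ¬p (no _)  = ≡.refl

𝟙-⇔ : (P → Q) → (Q → P) → (dP : Dec P) (dQ : Dec Q) → 𝟙 dP ≡ 𝟙 dQ
𝟙-⇔ f g (yes p) dQ     = ≡.sym (𝟙-yes (f p) dQ)
𝟙-⇔ f g (no ¬p) dQ     = ≡.sym (𝟙-no (λ q → ¬p (g q)) dQ)

𝟙-mono : (P → Q) → (dP : Dec P) (dQ : Dec Q) → 𝟙 dP ≤ 𝟙 dQ
𝟙-mono f (yes p) dQ = ℕₚ.≤-reflexive (≡.sym (𝟙-yes (f p) dQ))
𝟙-mono f (no _)  dQ = z≤n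

𝟙-reflect : (dP : Dec P) (dQ : Dec Q) → 𝟙 dP ≤ 𝟙 dQ → P → Q
𝟙-reflect dP (yes q) _ _ = q
𝟙-reflect (yes _) (no _) () _
𝟙-reflect (no ¬p) (no _) _ p = ⊥-elim (¬p p)

𝟙-⊎ : (P → Q → ⊥) → (R → P ⊎ Q) → (P ⊎ Q → R) →
      (dR : Dec R) (dP : Dec P) (dQ : Dec Q) → 𝟙 dR ≡ 𝟙 dP + 𝟙 dQ
𝟙-⊎ disj split join dR (yes p) dQ =
  ≡.trans (𝟙-yes (join (inj₁ p)) dR) (≡.cong suc (≡.sym (𝟙-no (disj p) dQ)))
𝟙-⊎ disj split join dR (no ¬p) dQ =
  𝟙-⇔ (λ r → [ (λ p → ⊥-elim (¬p p)) , (λ q → q) ]′ (split r)) (λ q → join (inj₂ q)) dR dQ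

open MonoidSum ℕₚ.+-0-commutativeMonoid using (sum-cong-≗; sum-replicate-zero) renaming (sum to ∑)

∑-const-1 : ∀ n → ∑ {n} (λ _ → 1) ≡ n
∑-const-1 zero    = ≡.refl
∑-const-1 (suc n) = ≡.cong suc (∑-const-1 n)

∑-𝟙-≡ : ∀ {n} (j : Fin n) → ∑ (λ i → 𝟙 (i Finₚ.≟ j)) ≡ 1
∑-𝟙-≡ {suc n} Fin.zero =
  ≡.cong suc (≡.trans (sum-cong-≗ {n} {y = λ _ → 0} (λ i → 𝟙-no (λ ()) (Fin.suc i Finₚ.≟ Fin.zero)))
                      (sum-replicate-zero n))
∑-𝟙-≡ {suc n} (Fin.suc j) = ≡.trans (≡.cong₂ _+_ (𝟙-no (λ ()) (Fin.zero Finₚ.≟ Fin.suc j)) shifted) (∑-𝟙-≡ j)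
  where
  shifted : ∑ (λ i → 𝟙 (Fin.suc i Finₚ.≟ Fin.suc j)) ≡ ∑ (λ i → 𝟙 (i Finₚ.≟ j))
  shifted = sum-cong-≗ (λ i → 𝟙-⇔ Finₚ.suc-injective (≡.cong Fin.suc) (Fin.suc i Finₚ.≟ Fin.suc j) (i Finₚ.≟ j))

∑-mono : ∀ {n} {f g : Fin n → ℕ} → (∀ i → f i ≤ g i) → ∑ f ≤ ∑ g
∑-mono {zero}  f≤g = z≤n
∑-mono {suc n} f≤g = ℕₚ.+-mono-≤ (f≤g Fin.zero) (∑-mono (λ i → f≤g (Fin.suc i)))

∑-squeeze : ∀ {n} {f g : Fin n → ℕ} → (∀ i → f i ≤ g i) → ∑ g ≤ ∑ f → ∀ i → g i ≤ f i
∑-squeeze {suc n} {f} {g} f≤g ∑g≤∑f Fin.zero =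
  ℕₚ.+-cancelʳ-≤ _ _ _ (ℕₚ.≤-trans ∑g≤∑f (ℕₚ.+-monoʳ-≤ (f Fin.zero) (∑-mono (λ i → f≤g (Fin.suc i)))))
∑-squeeze {suc n} {f} {g} f≤g ∑g≤∑f (Fin.suc i) =
  ∑-squeeze (λ i → f≤g (Fin.suc i))
    (ℕₚ.+-cancelˡ-≤ (g Fin.zero) _ _ (ℕₚ.≤-trans ∑g≤∑f (ℕₚ.+-monoˡ-≤ _ (f≤g Fin.zero)))) i

twice : ∀ k → 2 * k ≡ k + k
twice = solve-∀

halve : ∀ m n → m + m ≡ n + n → m ≡ n
halve m n m+m≡n+n = ℕₚ.*-cancelˡ-≡ m n 2 (≡.trans (twice m) (≡.trans m+m≡n+n (≡.sym (twice n))))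

even≢odd : ∀ m n → m + m ≢ n + (n + 1)
even≢odd m n m+m≡n+n+1 = ℕₚ.even≢odd m n (≡.trans (twice m) (≡.trans m+m≡n+n+1 (twice+1 n)))
  where
  twice+1 : ∀ k → k + (k + 1) ≡ suc (2 * k)
  twice+1 = solve-∀

module FiniteRing {c ℓ} (F : CommutativeRing c ℓ) {q : ℕ} (card : HasCardinality F q) where
  open CommutativeRing F renaming (_+_ to _+ᶠ_; _*_ to _*ᶠ_; _-_ to _-ᶠ_; -_ to -ᶠ_)
  open HasCardinality card
  open RingProperties ring using (+-identityʳ-unique)
  open SemiringMult semiring using (×-homo-+; ×1-homo-*) renaming (_×_ to _·_)

  private variable
    p p′ : Level
    A : Carrier → Set p
    B : Carrier → Set p′

  _≈?_ : ∀ x y → Dec (x ≈ y)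
  x ≈? y with to x Finₚ.≟ to y
  ... | yes same = yes (begin
    x           ≈⟨ from-to x ⟨
    from (to x) ≡⟨ ≡.cong from same ⟩
    from (to y) ≈⟨ from-to y ⟩
    y           ∎)
    where open SetoidReasoning setoid
  ... | no differ = no (λ x≈y → differ (to-cong x≈y))

  search : A Respects _≈_ → Decidable A → Dec (∃ A)
  search resp A? with Finₚ.any? (λ i → A? (from i))
  ... | yes (i , Ai) = yes (from i , Ai)
  ... | no none      = no (λ (x , Ax) → none (to x , resp (sym (from-to x)) Ax))

  record Permutation : Set (c ⊔ ℓ) where
    field
      apply          : Carrier → Carrier
      unapply        : Carrier → Carrier
      apply-cong     : ∀ {x y} → x ≈ y → apply x ≈ apply y
      unapply-cong   : ∀ {x y} → x ≈ y → unapply x ≈ unapply y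
      apply-unapply  : ∀ x → apply (unapply x) ≈ x
      unapply-apply  : ∀ x → unapply (apply x) ≈ x

    onIndices : FinPermutation.Permutation q q
    onIndices = FinPermutation.permutation (reindex apply) (reindex unapply)
                  (cancel apply-cong apply-unapply) (cancel unapply-cong unapply-apply)
      where
      reindex : (Carrier → Carrier) → Fin q → Fin q
      reindex f i = to (f (from i))
      cancel : ∀ {f g : Carrier → Carrier} → (∀ {x y} → x ≈ y → f x ≈ f y) → (∀ x → f (g x) ≈ x) →
               ∀ i → reindex f (reindex g i) ≡ i
      cancel f-cong fg i = ≡.trans (to-cong (trans (f-cong (from-to _)) (fg (from i)))) (to-from i)

  module CarrierSum {m ℓm} (M : CommutativeMonoid m ℓm) where
    open CommutativeMonoid M using (_∙_) renaming (Carrier to V; _≈_ to _≈ᴹ_; trans to transᴹ)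
    open MonoidSum M using (sum; sum-permute; sum-cong-≋; ∑-distrib-+; ∑-comm)

    ∑ₓ : (Carrier → V) → V
    ∑ₓ f = sum (λ i → f (from i))

    ∑ₓ-cong : ∀ {f g : Carrier → V} → (∀ x → f x ≈ᴹ g x) → ∑ₓ f ≈ᴹ ∑ₓ g
    ∑ₓ-cong f≈g = sum-cong-≋ {q} (λ i → f≈g (from i))

    ∑ₓ-distrib : ∀ (f g : Carrier → V) → ∑ₓ (λ x → f x ∙ g x) ≈ᴹ ∑ₓ f ∙ ∑ₓ g
    ∑ₓ-distrib f g = ∑-distrib-+ (λ i → f (from i)) (λ i → g (from i))

    ∑ₓ-comm : ∀ (h : Carrier → Carrier → V) → ∑ₓ (λ x → ∑ₓ (λ y → h x y)) ≈ᴹ ∑ₓ (λ y → ∑ₓ (λ x → h x y))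
    ∑ₓ-comm h = ∑-comm (λ i j → h (from i) (from j))

    ∑ₓ-permute : (σ : Permutation) {f : Carrier → V} → (∀ {x y} → x ≈ y → f x ≈ᴹ f y) →
                 ∑ₓ f ≈ᴹ ∑ₓ (λ x → f (Permutation.apply σ x))
    ∑ₓ-permute σ f-cong =
      transᴹ (sum-permute _ (Permutation.onIndices σ)) (∑ₓ-cong (λ x → f-cong (from-to (Permutation.apply σ x))))

  open CarrierSum ℕₚ.+-0-commutativeMonoid public
    renaming (∑ₓ to ∑ℕ; ∑ₓ-cong to ∑ℕ-cong; ∑ₓ-distrib to ∑ℕ-distrib; ∑ₓ-comm to ∑ℕ-comm; ∑ₓ-permute to ∑ℕ-permute)
  open CarrierSum +-commutativeMonoid
    using () renaming (∑ₓ to ∑F; ∑ₓ-cong to ∑F-cong; ∑ₓ-distrib to ∑F-distrib; ∑ₓ-permute to ∑F-permute)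

  # : Decidable A → ℕ
  # A? = ∑ℕ (λ x → 𝟙 (A? x))

  #-⇔ : (∀ x → A x → B x) → (∀ x → B x → A x) → (A? : Decidable A) (B? : Decidable B) → # A? ≡ # B?
  #-⇔ f g A? B? = ∑ℕ-cong (λ x → 𝟙-⇔ (f x) (g x) (A? x) (B? x))

  #-∅ : (∀ x → ¬ A x) → (A? : Decidable A) → # A? ≡ 0
  #-∅ none A? = ≡.trans (∑ℕ-cong (λ x → 𝟙-no (none x) (A? x))) (sum-replicate-zero q)

  #-full : (∀ x → A x) → (A? : Decidable A) → # A? ≡ q
  #-full all A? = ≡.trans (∑ℕ-cong (λ x → 𝟙-yes (all x) (A? x))) (∑-const-1 q)

  #-⊎ : ∀ {p″} {C : Carrier → Set p″} → (∀ x → A x → B x → ⊥) →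
        (∀ x → C x → A x ⊎ B x) → (∀ x → A x ⊎ B x → C x) →
        (C? : Decidable C) (A? : Decidable A) (B? : Decidable B) → # C? ≡ # A? + # B?
  #-⊎ disj split join C? A? B? =
    ≡.trans (∑ℕ-cong (λ x → 𝟙-⊎ (disj x) (split x) (join x) (C? x) (A? x) (B? x)))
            (∑ℕ-distrib (λ x → 𝟙 (A? x)) (λ x → 𝟙 (B? x)))

  #-≈ : ∀ a → # (_≈? a) ≡ 1
  #-≈ a = ≡.trans (sum-cong-≗ {q} (λ i → 𝟙-⇔ (index-of i) (element-of i) (from i ≈? a) (i Finₚ.≟ to a)))
                  (∑-𝟙-≡ (to a))
    where
    index-of : ∀ i → from i ≈ a → i ≡ to a
    index-of i eq = ≡.trans (≡.sym (to-from i)) (to-cong eq)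
    element-of : ∀ i → i ≡ to a → from i ≈ a
    element-of i ≡.refl = from-to a

  q≡1+#nonzero : q ≡ 1 + # (λ x → ¬? (x ≈? 0#))
  q≡1+#nonzero = begin
    q                                       ≡⟨ #-full (λ _ → tt) (λ _ → yes tt) ⟨
    # {A = λ _ → ⊤} (λ _ → yes tt)          ≡⟨ #-⊎ (λ x x≈0 x≉0 → x≉0 x≈0) (λ x _ → toSum (x ≈? 0#)) (λ _ _ → tt)
                                                    (λ _ → yes tt) (_≈? 0#) (λ x → ¬? (x ≈? 0#)) ⟩
    # (_≈? 0#) + # (λ x → ¬? (x ≈? 0#))     ≡⟨ ≡.cong (_+ # (λ x → ¬? (x ≈? 0#))) (#-≈ 0#) ⟩
    1 + # (λ x → ¬? (x ≈? 0#))              ∎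
    where open ≡.≡-Reasoning

  #-permute : (σ : Permutation) → B Respects _≈_ →
              (∀ x → A x → B (Permutation.apply σ x)) → (∀ x → B (Permutation.apply σ x) → A x) →
              (A? : Decidable A) (B? : Decidable B) → # A? ≡ # B?
  #-permute σ B-resp f g A? B? =
    ≡.trans (#-⇔ f g A? (λ x → B? (apply x)))
            (≡.sym (∑ℕ-permute σ (λ x≈y → 𝟙-⇔ (B-resp x≈y) (B-resp (sym x≈y)) (B? _) (B? _))))
    where open Permutation σ

  #-rigid : (σ : Permutation) → A Respects _≈_ → B Respects _≈_ →
            (∀ x → A x → B (Permutation.apply σ x)) → (A? : Decidable A) (B? : Decidable B) →
            # B? ≤ # A? → ∀ x → B (Permutation.apply σ x) → A x
  #-rigid σ A-resp B-resp f A? B? #B≤#A x Bσx =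
    A-resp (from-to x) (𝟙-reflect (B? (apply (from (to x)))) (A? (from (to x)))
                          (∑-squeeze (λ i → 𝟙-mono (f (from i)) (A? _) (B? _)) #Bσ≤#A (to x))
                          (B-resp (apply-cong (sym (from-to x))) Bσx))
    where
    open Permutation σ
    #Bσ≤#A : ∑ℕ (λ y → 𝟙 (B? (apply y))) ≤ # A?
    #Bσ≤#A = ℕₚ.≤-trans (ℕₚ.≤-reflexive (#-permute σ B-resp (λ _ b → b) (λ _ b → b) (λ y → B? (apply y)) B?)) #B≤#A

  ⟦_⟧ : ℕ → Carrier
  ⟦ n ⟧ = n · 1#

  ⟦sum⟧ : ∀ {n} (f : Fin n → ℕ) → MonoidSum.sum +-commutativeMonoid (λ i → ⟦ f i ⟧) ≈ ⟦ ∑ f ⟧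
  ⟦sum⟧ {zero}  f = refl
  ⟦sum⟧ {suc n} f = trans (+-congˡ (⟦sum⟧ (λ i → f (Fin.suc i)))) (sym (×-homo-+ 1# (f Fin.zero) _))

  translation : Permutation
  translation = record
    { apply = _+ᶠ 1# ; unapply = _-ᶠ 1# ; apply-cong = +-congʳ ; unapply-cong = +-congʳ
    ; apply-unapply = λ x → cancel x (-‿inverseˡ 1#) ; unapply-apply = λ x → cancel x (-‿inverseʳ 1#) }
    where
    cancel : ∀ x {u v} → u +ᶠ v ≈ 0# → (x +ᶠ u) +ᶠ v ≈ x
    cancel x {u} {v} u+v≈0 = trans (+-assoc x u v) (trans (+-congˡ u+v≈0) (+-identityʳ x))

  -- A translation-invariant set has a number of elements that vanishes in F:
  -- with χ = 𝟙_A, summing χ(x)·x over x and over x + 1 gives ∑ χ(x)·x = ∑ χ(x)·x + ∑ χ(x).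
  translation-invariant-count : A Respects _≈_ → (∀ x → A x → A (x +ᶠ 1#)) → (∀ x → A (x +ᶠ 1#) → A x) →
                                (A? : Decidable A) → ⟦ # A? ⟧ ≈ 0#
  translation-invariant-count A-resp up down A? = begin
    ⟦ # A? ⟧   ≈⟨ ⟦sum⟧ (λ i → 𝟙 (A? (from i))) ⟨
    ∑F χ       ≈⟨ +-identityʳ-unique (∑F weighted) (∑F χ) ∑weighted≈∑weighted+∑χ ⟩
    0#         ∎
    where
    open SetoidReasoning setoid
    χ weighted : Carrier → Carrier
    χ x = ⟦ 𝟙 (A? x) ⟧
    weighted x = χ x *ᶠ x
    χ-shift : ∀ x → χ (x +ᶠ 1#) ≡ χ x
    χ-shift x = ≡.cong ⟦_⟧ (𝟙-⇔ (down x) (up x) (A? (x +ᶠ 1#)) (A? x))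
    weighted-cong : ∀ {x y} → x ≈ y → weighted x ≈ weighted y
    weighted-cong x≈y = *-cong (reflexive (≡.cong ⟦_⟧ (𝟙-⇔ (A-resp x≈y) (A-resp (sym x≈y)) (A? _) (A? _)))) x≈y
    ∑weighted≈∑weighted+∑χ : ∑F weighted +ᶠ ∑F χ ≈ ∑F weighted
    ∑weighted≈∑weighted+∑χ = sym (begin
      ∑F weighted                           ≈⟨ ∑F-permute translation weighted-cong ⟩
      ∑F (λ x → χ (x +ᶠ 1#) *ᶠ (x +ᶠ 1#))   ≈⟨ ∑F-cong shifted ⟩
      ∑F (λ x → weighted x +ᶠ χ x)          ≈⟨ ∑F-distrib weighted χ ⟩
      ∑F weighted +ᶠ ∑F χ                   ∎)
      where
      shifted : ∀ x → χ (x +ᶠ 1#) *ᶠ (x +ᶠ 1#) ≈ weighted x +ᶠ χ x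
      shifted x = begin
        χ (x +ᶠ 1#) *ᶠ (x +ᶠ 1#)   ≈⟨ *-congʳ (reflexive (χ-shift x)) ⟩
        χ x *ᶠ (x +ᶠ 1#)           ≈⟨ distribˡ (χ x) x 1# ⟩
        χ x *ᶠ x +ᶠ χ x *ᶠ 1#      ≈⟨ +-congˡ (*-identityʳ (χ x)) ⟩
        weighted x +ᶠ χ x          ∎

  ⟦q⟧≈0 : ⟦ q ⟧ ≈ 0#
  ⟦q⟧≈0 = ≡.subst (λ n → ⟦ n ⟧ ≈ 0#) (#-full (λ _ → tt) (λ _ → yes tt))
            (translation-invariant-count (λ _ t → t) (λ _ t → t) (λ _ t → t) (λ _ → yes tt))

  ⟦m⟧≉0 : ¬ 0# ≈ 1# → ∀ k m → q ≡ k * m + 1 → ¬ ⟦ m ⟧ ≈ 0#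
  ⟦m⟧≉0 0≉1 k m q≡km+1 ⟦m⟧≈0 = 0≉1 (begin
    0#                   ≈⟨ ⟦q⟧≈0 ⟨
    ⟦ q ⟧                ≡⟨ ≡.cong ⟦_⟧ q≡km+1 ⟩
    ⟦ k * m + 1 ⟧        ≈⟨ ×-homo-+ 1# (k * m) 1 ⟩
    ⟦ k * m ⟧ +ᶠ ⟦ 1 ⟧     ≈⟨ +-congʳ (×1-homo-* k m) ⟩
    ⟦ k ⟧ *ᶠ ⟦ m ⟧ +ᶠ ⟦ 1 ⟧ ≈⟨ +-cong (trans (*-congˡ ⟦m⟧≈0) (zeroʳ ⟦ k ⟧)) (+-identityʳ 1#) ⟩
    0# +ᶠ 1#             ≈⟨ +-identityˡ 1# ⟩
    1#                   ∎)
    where open SetoidReasoning setoid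

module FiniteField {c ℓ} (F : CommutativeRing c ℓ) (isField : IsField F) {q : ℕ} (card : HasCardinality F q) where
  open CommutativeRing F renaming (_+_ to _+ᶠ_; _*_ to _*ᶠ_; _-_ to _-ᶠ_; -_ to -ᶠ_)
  open IsField isField
  open FiniteRing F card
  open RingProperties ring using (+-inverseˡ-unique; x∙y⁻¹≈ε⇒x≈y; -‿distribˡ-*; -‿distribʳ-*; -‿involutive; [y-z]x≈yx-zx)
  open CommutativeMonoidSolver *-commutativeMonoid using (solve; _⊜_; _⊕_)

  1≉0 : ¬ 1# ≈ 0#
  1≉0 1≈0 = 0≉1 (sym 1≈0)

  no-zero-divisors : ∀ {a b} → a *ᶠ b ≈ 0# → ¬ a ≈ 0# → b ≈ 0#
  no-zero-divisors {a} {b} ab≈0 a≉0 with inverse a a≉0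
  ... | a′ , aa′≈1 = begin
    b                ≈⟨ *-identityˡ b ⟨
    1# *ᶠ b          ≈⟨ *-congʳ aa′≈1 ⟨
    (a *ᶠ a′) *ᶠ b   ≈⟨ solve 3 (λ a a′ b → ((a ⊕ a′) ⊕ b) ⊜ (a′ ⊕ (a ⊕ b))) refl a a′ b ⟩
    a′ *ᶠ (a *ᶠ b)   ≈⟨ *-congˡ ab≈0 ⟩
    a′ *ᶠ 0#         ≈⟨ zeroʳ a′ ⟩
    0#               ∎
    where open SetoidReasoning setoid

  *-nonzero : ∀ {a b} → ¬ a ≈ 0# → ¬ b ≈ 0# → ¬ a *ᶠ b ≈ 0#
  *-nonzero a≉0 b≉0 ab≈0 = b≉0 (no-zero-divisors ab≈0 a≉0)

  invertible-nonzero : ∀ {a b} → a *ᶠ b ≈ 1# → ¬ a ≈ 0#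
  invertible-nonzero {a} {b} ab≈1 a≈0 = 1≉0 (trans (sym ab≈1) (trans (*-congʳ a≈0) (zeroˡ b)))

  inverse-unique : ∀ {a b b′} → a *ᶠ b ≈ 1# → a *ᶠ b′ ≈ 1# → b ≈ b′
  inverse-unique {a} {b} {b′} ab≈1 ab′≈1 = begin
    b                ≈⟨ *-identityʳ b ⟨
    b *ᶠ 1#          ≈⟨ *-congˡ ab′≈1 ⟨
    b *ᶠ (a *ᶠ b′)   ≈⟨ solve 3 (λ a b b′ → (b ⊕ (a ⊕ b′)) ⊜ ((a ⊕ b) ⊕ b′)) refl a b b′ ⟩
    (a *ᶠ b) *ᶠ b′   ≈⟨ *-congʳ ab≈1 ⟩
    1# *ᶠ b′         ≈⟨ *-identityˡ b′ ⟩
    b′               ∎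
    where open SetoidReasoning setoid

  square-roots : ∀ {x y} → x *ᶠ x ≈ y *ᶠ y → x ≈ y ⊎ x ≈ -ᶠ y
  square-roots {x} {y} x²≈y² with (x -ᶠ y) ≈? 0#
  ... | yes x-y≈0 = inj₁ (x∙y⁻¹≈ε⇒x≈y x y x-y≈0)
  ... | no  x-y≉0 = inj₂ (+-inverseˡ-unique x y (no-zero-divisors difference-of-squares x-y≉0))
    where
    difference-of-squares : (x -ᶠ y) *ᶠ (x +ᶠ y) ≈ 0#
    difference-of-squares = begin
      (x -ᶠ y) *ᶠ (x +ᶠ y)                            ≈⟨ [y-z]x≈yx-zx (x +ᶠ y) x y ⟩
      x *ᶠ (x +ᶠ y) -ᶠ y *ᶠ (x +ᶠ y)                  ≈⟨ +-cong (distribˡ x x y) (-‿cong (distribˡ y x y)) ⟩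
      (x *ᶠ x +ᶠ x *ᶠ y) -ᶠ (y *ᶠ x +ᶠ y *ᶠ y)        ≈⟨ +-cong (+-cong x²≈y² (*-comm x y)) (-‿cong (+-comm (y *ᶠ x) (y *ᶠ y))) ⟩
      (y *ᶠ y +ᶠ y *ᶠ x) -ᶠ (y *ᶠ y +ᶠ y *ᶠ x)        ≈⟨ -‿inverseʳ _ ⟩
      0#                                              ∎
      where open SetoidReasoning setoid

  neg-square : ∀ r → (-ᶠ r) *ᶠ (-ᶠ r) ≈ r *ᶠ r
  neg-square r = begin
    (-ᶠ r) *ᶠ (-ᶠ r)     ≈⟨ -‿distribˡ-* r (-ᶠ r) ⟨
    -ᶠ (r *ᶠ (-ᶠ r))     ≈⟨ -‿cong (-‿distribʳ-* r r) ⟨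
    -ᶠ (-ᶠ (r *ᶠ r))     ≈⟨ -‿involutive (r *ᶠ r) ⟩
    r *ᶠ r               ∎
    where open SetoidReasoning setoid

  _⁻¹ : Carrier → Carrier
  x ⁻¹ with x ≈? 0#
  ... | yes _   = 0#
  ... | no x≉0 = proj₁ (inverse x x≉0)

  ⁻¹-spec : ∀ x → (x ≈ 0# × x ⁻¹ ≈ 0#) ⊎ (x *ᶠ x ⁻¹ ≈ 1#)
  ⁻¹-spec x with x ≈? 0#
  ... | yes x≈0 = inj₁ (x≈0 , refl)
  ... | no x≉0  = inj₂ (proj₂ (inverse x x≉0))

  ⁻¹-inverse : ∀ {x} → ¬ x ≈ 0# → x *ᶠ x ⁻¹ ≈ 1#
  ⁻¹-inverse {x} x≉0 with ⁻¹-spec x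
  ... | inj₁ (x≈0 , _) = ⊥-elim (x≉0 x≈0)
  ... | inj₂ xx⁻¹≈1   = xx⁻¹≈1

  ⁻¹-zero : ∀ {x} → x ≈ 0# → x ⁻¹ ≈ 0#
  ⁻¹-zero {x} x≈0 with ⁻¹-spec x
  ... | inj₁ (_ , x⁻¹≈0) = x⁻¹≈0
  ... | inj₂ xx⁻¹≈1      = ⊥-elim (invertible-nonzero xx⁻¹≈1 x≈0)

  ⁻¹-cong : ∀ {x y} → x ≈ y → x ⁻¹ ≈ y ⁻¹
  ⁻¹-cong {x} {y} x≈y with ⁻¹-spec x | ⁻¹-spec y
  ... | inj₁ (_ , x⁻¹≈0) | inj₁ (_ , y⁻¹≈0) = trans x⁻¹≈0 (sym y⁻¹≈0)
  ... | inj₁ (x≈0 , _)   | inj₂ yy⁻¹≈1      = ⊥-elim (invertible-nonzero yy⁻¹≈1 (trans (sym x≈y) x≈0))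
  ... | inj₂ xx⁻¹≈1      | inj₁ (y≈0 , _)   = ⊥-elim (invertible-nonzero xx⁻¹≈1 (trans x≈y y≈0))
  ... | inj₂ xx⁻¹≈1      | inj₂ yy⁻¹≈1      = inverse-unique xx⁻¹≈1 (trans (*-congʳ x≈y) yy⁻¹≈1)

  ⁻¹-involutive : ∀ x → (x ⁻¹) ⁻¹ ≈ x
  ⁻¹-involutive x with ⁻¹-spec x | ⁻¹-spec (x ⁻¹)
  ... | inj₁ (x≈0 , _)   | inj₁ (_ , x⁻¹⁻¹≈0) = trans x⁻¹⁻¹≈0 (sym x≈0)
  ... | inj₁ (_ , x⁻¹≈0) | inj₂ x⁻¹x⁻¹⁻¹≈1   = ⊥-elim (invertible-nonzero x⁻¹x⁻¹⁻¹≈1 x⁻¹≈0)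
  ... | inj₂ xx⁻¹≈1      | inj₁ (x⁻¹≈0 , _)   = ⊥-elim (invertible-nonzero (trans (*-comm _ _) xx⁻¹≈1) x⁻¹≈0)
  ... | inj₂ xx⁻¹≈1      | inj₂ x⁻¹x⁻¹⁻¹≈1   = inverse-unique x⁻¹x⁻¹⁻¹≈1 (trans (*-comm _ _) xx⁻¹≈1)

  inversion : Permutation
  inversion = record
    { apply = _⁻¹ ; unapply = _⁻¹ ; apply-cong = ⁻¹-cong ; unapply-cong = ⁻¹-cong
    ; apply-unapply = ⁻¹-involutive ; unapply-apply = ⁻¹-involutive }

  scaling : ∀ {a a′} → a *ᶠ a′ ≈ 1# → Permutation
  scaling {a} {a′} aa′≈1 = record
    { apply = a *ᶠ_ ; unapply = a′ *ᶠ_ ; apply-cong = *-congˡ ; unapply-cong = *-congˡ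
    ; apply-unapply = cancel aa′≈1 ; unapply-apply = cancel (trans (*-comm a′ a) aa′≈1) }
    where
    cancel : ∀ {b b′} → b *ᶠ b′ ≈ 1# → ∀ x → b *ᶠ (b′ *ᶠ x) ≈ x
    cancel {b} {b′} bb′≈1 x = trans (sym (*-assoc b b′ x)) (trans (*-congʳ bb′≈1) (*-identityˡ x))

  IsSquare : Carrier → Set (c ⊔ ℓ)
  IsSquare x = ∃ λ y → y *ᶠ y ≈ x

  square? : Decidable IsSquare
  square? x = search (λ y≈z y²≈x → trans (*-cong (sym y≈z) (sym y≈z)) y²≈x) (λ y → (y *ᶠ y) ≈? x)

  QR? : Decidable (QR F)
  QR? x = ¬? (x ≈? 0#) ×-dec square? x

  NQR? : Decidable (NQR F)
  NQR? x = ¬? (x ≈? 0#) ×-dec ¬? (QR? x)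

  QR-resp : QR F Respects _≈_
  QR-resp x≈y (x≉0 , (r , r²≈x)) = (λ y≈0 → x≉0 (trans x≈y y≈0)) , (r , trans r²≈x x≈y)

  NQR-resp : NQR F Respects _≈_
  NQR-resp x≈y (x≉0 , ¬qr) = (λ y≈0 → x≉0 (trans x≈y y≈0)) , (λ qr → ¬qr (QR-resp (sym x≈y) qr))

  QR-or-NQR : ∀ {x} → ¬ x ≈ 0# → QR F x ⊎ NQR F x
  QR-or-NQR {x} x≉0 with QR? x
  ... | yes qr = inj₁ qr
  ... | no ¬qr = inj₂ (x≉0 , ¬qr)

  1-QR : QR F 1#
  1-QR = 1≉0 , (1# , *-identityˡ 1#)

  square-QR : ∀ {x} → ¬ x ≈ 0# → QR F (x *ᶠ x)
  square-QR x≉0 = *-nonzero x≉0 x≉0 , (_ , refl)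

  root-nonzero : ∀ {a r} → ¬ a ≈ 0# → r *ᶠ r ≈ a → ¬ r ≈ 0#
  root-nonzero {a} {r} a≉0 r²≈a r≈0 = a≉0 (trans (sym r²≈a) (trans (*-congʳ r≈0) (zeroˡ r)))

  -- If a ≠ 0 and a, a·b are squares then so is b: (s/r)² = b when r² = a, s² = a·b.
  square-cancel : ∀ {a b} → ¬ a ≈ 0# → IsSquare a → IsSquare (a *ᶠ b) → IsSquare b
  square-cancel {a} {b} a≉0 (r , r²≈a) (s , s²≈ab) with inverse r (root-nonzero a≉0 r²≈a)
  ... | r′ , rr′≈1 = s *ᶠ r′ , (begin
    (s *ᶠ r′) *ᶠ (s *ᶠ r′)           ≈⟨ solve 2 (λ s r′ → ((s ⊕ r′) ⊕ (s ⊕ r′)) ⊜ ((s ⊕ s) ⊕ (r′ ⊕ r′))) refl s r′ ⟩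
    (s *ᶠ s) *ᶠ (r′ *ᶠ r′)           ≈⟨ *-congʳ (trans s²≈ab (*-congʳ (sym r²≈a))) ⟩
    ((r *ᶠ r) *ᶠ b) *ᶠ (r′ *ᶠ r′)    ≈⟨ solve 3 (λ r b r′ → (((r ⊕ r) ⊕ b) ⊕ (r′ ⊕ r′)) ⊜ (((r ⊕ r′) ⊕ (r ⊕ r′)) ⊕ b)) refl r b r′ ⟩
    ((r *ᶠ r′) *ᶠ (r *ᶠ r′)) *ᶠ b    ≈⟨ *-congʳ (*-cong rr′≈1 rr′≈1) ⟩
    (1# *ᶠ 1#) *ᶠ b                  ≈⟨ *-congʳ (*-identityˡ 1#) ⟩
    1# *ᶠ b                          ≈⟨ *-identityˡ b ⟩
    b                                ∎)
    where open SetoidReasoning setoid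

  QR*NQR : ∀ {a b} → QR F a → NQR F b → NQR F (a *ᶠ b)
  QR*NQR (a≉0 , sq-a) (b≉0 , ¬qr-b) =
    *-nonzero a≉0 b≉0 , (λ (_ , sq-ab) → ¬qr-b (b≉0 , square-cancel a≉0 sq-a sq-ab))

  NQR*QR : ∀ {a b} → NQR F a → QR F b → NQR F (a *ᶠ b)
  NQR*QR {a} {b} nqr-a qr-b = NQR-resp (*-comm b a) (QR*NQR qr-b nqr-a)

  -- The inverse of a nonresidue is a nonresidue (a·b = 1 is a square).
  NQR-inverse : ∀ {a b} → a *ᶠ b ≈ 1# → NQR F b → NQR F a
  NQR-inverse ab≈1 (b≉0 , ¬qr-b) =
    invertible-nonzero ab≈1 ,
    (λ (_ , sq-a) → ¬qr-b (b≉0 , square-cancel (invertible-nonzero ab≈1) sq-a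
                                    (1# , trans (*-identityˡ 1#) (sym ab≈1))))

  NQR-partner : ∀ {a b} → QR F (a *ᶠ b) → NQR F a → ¬ b ≈ 0# → NQR F b
  NQR-partner qr-ab nqr-a b≉0 with QR-or-NQR b≉0
  ... | inj₁ qr-b  = ⊥-elim (proj₂ (NQR*QR nqr-a qr-b) qr-ab)
  ... | inj₂ nqr-b = nqr-b

  -- In odd characteristic, half of the nonzero elements are squares.
  module OddCharacteristic (two≉0 : ¬ 1# +ᶠ 1# ≈ 0#) where

    self-negative : ∀ {r} → r ≈ -ᶠ r → r ≈ 0#
    self-negative {r} r≈-r = no-zero-divisors 2r≈0 two≉0
      where
      2r≈0 : (1# +ᶠ 1#) *ᶠ r ≈ 0#
      2r≈0 = begin
        (1# +ᶠ 1#) *ᶠ r        ≈⟨ distribʳ r 1# 1# ⟩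
        1# *ᶠ r +ᶠ 1# *ᶠ r     ≈⟨ +-cong (*-identityˡ r) (*-identityˡ r) ⟩
        r +ᶠ r                 ≈⟨ +-congˡ r≈-r ⟩
        r -ᶠ r                 ≈⟨ -‿inverseʳ r ⟩
        0#                     ∎
        where open SetoidReasoning setoid

    RootOf : Carrier → Carrier → Set (c ⊔ ℓ)
    RootOf x y = QR F y × x *ᶠ x ≈ y

    RootOf? : ∀ x y → Dec (RootOf x y)
    RootOf? x y = QR? y ×-dec ((x *ᶠ x) ≈? y)

    residues-with-root : ∀ x → # (RootOf? x) ≡ 𝟙 (¬? (x ≈? 0#))
    residues-with-root x with x ≈? 0#
    ... | yes x≈0 = #-∅ (λ y (qr-y , x²≈y) → proj₁ qr-y (trans (sym x²≈y) (trans (*-congʳ x≈0) (zeroˡ x))))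
                        (RootOf? x)
    ... | no x≉0 = ≡.trans (#-⇔ (λ y (_ , x²≈y) → sym x²≈y)
                               (λ y y≈x² → QR-resp (sym y≈x²) (square-QR x≉0) , sym y≈x²)
                               (RootOf? x) (_≈? (x *ᶠ x)))
                           (#-≈ (x *ᶠ x))

    roots-of : ∀ y (qr? : Dec (QR F y)) → # (λ x → RootOf? x y) ≡ 𝟙 qr? + 𝟙 qr?
    roots-of y (no ¬qr-y) = #-∅ (λ x (qr-y , _) → ¬qr-y qr-y) (λ x → RootOf? x y)
    roots-of y (yes qr-y@(y≉0 , (r , r²≈y))) =
      ≡.trans (#-⊎ distinct split join (λ x → RootOf? x y) (_≈? r) (_≈? (-ᶠ r)))
              (≡.cong₂ _+_ (#-≈ r) (#-≈ (-ᶠ r)))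
      where
      distinct : ∀ x → x ≈ r → x ≈ -ᶠ r → ⊥
      distinct x x≈r x≈-r = root-nonzero y≉0 r²≈y (self-negative (trans (sym x≈r) x≈-r))
      split : ∀ x → RootOf x y → x ≈ r ⊎ x ≈ -ᶠ r
      split x (_ , x²≈y) = square-roots (trans x²≈y (sym r²≈y))
      join : ∀ x → x ≈ r ⊎ x ≈ -ᶠ r → RootOf x y
      join x (inj₁ x≈r)  = qr-y , trans (*-cong x≈r x≈r) r²≈y
      join x (inj₂ x≈-r) = qr-y , trans (*-cong x≈-r x≈-r) (trans (neg-square r) r²≈y)

    -- Counting the pairs (x , x²) in two ways: #(F*) = 2 · #QR.
    #nonzero≡#QR+#QR : # (λ x → ¬? (x ≈? 0#)) ≡ # QR? + # QR?
    #nonzero≡#QR+#QR = begin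
      # (λ x → ¬? (x ≈? 0#))                       ≡⟨ ∑ℕ-cong residues-with-root ⟨
      ∑ℕ (λ x → # (RootOf? x))                     ≡⟨ ∑ℕ-comm (λ x y → 𝟙 (RootOf? x y)) ⟩
      ∑ℕ (λ y → # (λ x → RootOf? x y))             ≡⟨ ∑ℕ-cong (λ y → roots-of y (QR? y)) ⟩
      ∑ℕ (λ y → 𝟙 (QR? y) + 𝟙 (QR? y))             ≡⟨ ∑ℕ-distrib (λ y → 𝟙 (QR? y)) (λ y → 𝟙 (QR? y)) ⟩
      # QR? + # QR?                                ∎
      where open ≡.≡-Reasoning

    #QR≡#NQR : # QR? ≡ # NQR?
    #QR≡#NQR = ℕₚ.+-cancelˡ-≡ (# QR?) _ _ (≡.trans (≡.sym #nonzero≡#QR+#QR) #nonzero≡#QR+#NQR)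
      where
      #nonzero≡#QR+#NQR : # (λ x → ¬? (x ≈? 0#)) ≡ # QR? + # NQR?
      #nonzero≡#QR+#NQR = #-⊎ (λ x qr (_ , ¬qr) → ¬qr qr) (λ x → QR-or-NQR) (λ x → [ proj₁ , proj₁ ]′)
                              (λ x → ¬? (x ≈? 0#)) QR? NQR?

    -- Nonresidue times nonresidue is a residue: multiplication by a nonresidue a maps
    -- QR into NQR, and as #QR = #NQR it maps QR onto NQR.
    NQR*NQR : ∀ {a b} → NQR F a → NQR F b → QR F (a *ᶠ b)
    NQR*NQR {a} {b} nqr-a@(a≉0 , _) (b≉0 , ¬qr-b) with inverse a a≉0
    ... | a′ , aa′≈1 with QR-or-NQR (*-nonzero a≉0 b≉0)
    ...   | inj₁ qr-ab  = qr-ab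
    ...   | inj₂ nqr-ab = ⊥-elim (¬qr-b (#-rigid (scaling aa′≈1) QR-resp NQR-resp (λ x → NQR*QR nqr-a)
                                            QR? NQR? (ℕₚ.≤-reflexive (≡.sym #QR≡#NQR)) b nqr-ab))

  module OneModFour (w : ℕ) (q≡4w+1 : q ≡ 4 * w + 1) where
    -- q is odd, so 2 ≠ 0 in F.
    two≉0 : ¬ 1# +ᶠ 1# ≈ 0#
    two≉0 2≈0 = ⟦m⟧≉0 0≉1 (w + w) 2 (≡.trans q≡4w+1 (four w)) (trans (+-congˡ (+-identityʳ 1#)) 2≈0)
      where
      four : ∀ w → 4 * w + 1 ≡ (w + w) * 2 + 1
      four = solve-∀

    open OddCharacteristic two≉0

    #NQR≡w+w : # NQR? ≡ w + w
    #NQR≡w+w = halve (# NQR?) (w + w) (ℕₚ.suc-injective (begin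
      1 + (# NQR? + # NQR?)     ≡⟨ ≡.cong (λ n → 1 + (n + # NQR?)) #QR≡#NQR ⟨
      1 + (# QR? + # NQR?)      ≡⟨ ≡.cong (λ n → 1 + (# QR? + n)) #QR≡#NQR ⟨
      1 + (# QR? + # QR?)       ≡⟨ ≡.cong suc #nonzero≡#QR+#QR ⟨
      1 + # (λ x → ¬? (x ≈? 0#)) ≡⟨ q≡1+#nonzero ⟨
      q                         ≡⟨ q≡4w+1 ⟩
      4 * w + 1                 ≡⟨ four w ⟩
      1 + ((w + w) + (w + w))   ∎))
      where
      open ≡.≡-Reasoning
      four : ∀ w → 4 * w + 1 ≡ 1 + ((w + w) + (w + w))
      four = solve-∀

    NRthenR NRthenNR NRthen0 : Carrier → Set (c ⊔ ℓ)
    NRthenR x  = NQR F x × QR F (x +ᶠ 1#)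
    NRthenNR x = NQR F x × NQR F (x +ᶠ 1#)
    NRthen0 x  = NQR F x × x +ᶠ 1# ≈ 0#

    NRthenR? : Decidable NRthenR
    NRthenR? x = NQR? x ×-dec QR? (x +ᶠ 1#)

    NRthenNR? : Decidable NRthenNR
    NRthenNR? x = NQR? x ×-dec NQR? (x +ᶠ 1#)

    NRthen0? : Decidable NRthen0
    NRthen0? x = NQR? x ×-dec ((x +ᶠ 1#) ≈? 0#)

    NRthenR-resp : NRthenR Respects _≈_
    NRthenR-resp x≈y (nqr-x , qr-x+1) = NQR-resp x≈y nqr-x , QR-resp (+-congʳ x≈y) qr-x+1

    NRthenNR-resp : NRthenNR Respects _≈_
    NRthenNR-resp x≈y (nqr-x , nqr-x+1) = NQR-resp x≈y nqr-x , NQR-resp (+-congʳ x≈y) nqr-x+1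

    #NQR≡#NRthenR+#NRthenNR+#NRthen0 : # NQR? ≡ # NRthenR? + (# NRthenNR? + # NRthen0?)
    #NQR≡#NRthenR+#NRthenNR+#NRthen0 =
      ≡.trans (#-⊎ (λ x (_ , qr) → [ (λ (_ , (_ , ¬qr)) → ¬qr qr) , (λ (_ , x+1≈0) → proj₁ qr x+1≈0) ]′)
                   classify (λ x → [ proj₁ , [ proj₁ , proj₁ ]′ ]′)
                   NQR? NRthenR? (λ x → NRthenNR? x ⊎-dec NRthen0? x))
              (≡.cong (# NRthenR? +_)
                 (#-⊎ (λ x (_ , (x+1≉0 , _)) (_ , x+1≈0) → x+1≉0 x+1≈0) (λ x p → p) (λ x p → p)
                      (λ x → NRthenNR? x ⊎-dec NRthen0? x) NRthenNR? NRthen0?))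
      where
      classify : ∀ x → NQR F x → NRthenR x ⊎ (NRthenNR x ⊎ NRthen0 x)
      classify x nqr-x with (x +ᶠ 1#) ≈? 0#
      ... | yes x+1≈0 = inj₂ (inj₂ (nqr-x , x+1≈0))
      ... | no x+1≉0 with QR-or-NQR x+1≉0
      ...   | inj₁ qr  = inj₁ (nqr-x , qr)
      ...   | inj₂ nqr = inj₂ (inj₁ (nqr-x , nqr))

    inverse-shift : ∀ {a b} → a *ᶠ b ≈ 1# → a *ᶠ (b +ᶠ 1#) ≈ a +ᶠ 1#
    inverse-shift {a} {b} ab≈1 = trans (distribˡ a b 1#) (trans (+-cong ab≈1 (*-identityʳ a)) (+-comm 1# a))

    -- Inversion exchanges the two kinds of nonresidues: x⁻¹ + 1 = x⁻¹·(x + 1).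
    #NRthenNR≡#NRthenR : # NRthenNR? ≡ # NRthenR?
    #NRthenNR≡#NRthenR = #-permute inversion NRthenR-resp forward backward NRthenNR? NRthenR?
      where
      forward : ∀ x → NRthenNR x → NRthenR (x ⁻¹)
      forward x (nqr-x@(x≉0 , _) , nqr-x+1) =
        nqr-x⁻¹ , QR-resp (inverse-shift x⁻¹x≈1) (NQR*NQR nqr-x⁻¹ nqr-x+1)
        where
        x⁻¹x≈1 : x ⁻¹ *ᶠ x ≈ 1#
        x⁻¹x≈1 = trans (*-comm _ _) (⁻¹-inverse x≉0)
        nqr-x⁻¹ : NQR F (x ⁻¹)
        nqr-x⁻¹ = NQR-inverse x⁻¹x≈1 nqr-x
      backward : ∀ x → NRthenR (x ⁻¹) → NRthenNR x
      backward x (nqr-x⁻¹@(x⁻¹≉0 , _) , qr-x⁻¹+1) =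
        nqr-x , NQR-resp (inverse-shift xx⁻¹≈1) (NQR*QR nqr-x qr-x⁻¹+1)
        where
        x≉0 : ¬ x ≈ 0#
        x≉0 x≈0 = x⁻¹≉0 (⁻¹-zero x≈0)
        xx⁻¹≈1 : x *ᶠ x ⁻¹ ≈ 1#
        xx⁻¹≈1 = ⁻¹-inverse x≉0
        nqr-x : NQR F x
        nqr-x = NQR-inverse xx⁻¹≈1 nqr-x⁻¹

    NRthen0-minus-one : ∀ {x} → NRthen0 x → x ≈ -ᶠ 1#
    NRthen0-minus-one {x} (_ , x+1≈0) = +-inverseˡ-unique x 1# x+1≈0

    -- -1 is a residue: otherwise NRthen0 = {-1} and #NQR = 2·#NRthenNR + 1 would be odd.
    minus-one-not-NQR : ¬ NQR F (-ᶠ 1#)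
    minus-one-not-NQR nqr-[-1] = even≢odd w (# NRthenNR?) (begin
      w + w                                     ≡⟨ #NQR≡w+w ⟨
      # NQR?                                    ≡⟨ #NQR≡#NRthenR+#NRthenNR+#NRthen0 ⟩
      # NRthenR? + (# NRthenNR? + # NRthen0?)   ≡⟨ ≡.cong₂ _+_ (≡.sym #NRthenNR≡#NRthenR) (≡.cong (# NRthenNR? +_) #NRthen0≡1) ⟩
      # NRthenNR? + (# NRthenNR? + 1)           ∎)
      where
      open ≡.≡-Reasoning
      #NRthen0≡1 : # NRthen0? ≡ 1
      #NRthen0≡1 = ≡.trans (#-⇔ (λ x → NRthen0-minus-one)
                                (λ x x≈-1 → NQR-resp (sym x≈-1) nqr-[-1] , trans (+-congʳ x≈-1) (-‿inverseˡ 1#))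
                                NRthen0? (_≈? (-ᶠ 1#)))
                           (#-≈ (-ᶠ 1#))

    #NRthenNR≡w : # NRthenNR? ≡ w
    #NRthenNR≡w = halve (# NRthenNR?) w (begin
      # NRthenNR? + # NRthenNR?                 ≡⟨ ≡.cong₂ _+_ #NRthenNR≡#NRthenR (≡.sym (ℕₚ.+-identityʳ _)) ⟩
      # NRthenR? + (# NRthenNR? + 0)            ≡⟨ ≡.cong (λ n → # NRthenR? + (# NRthenNR? + n)) #NRthen0≡0 ⟨
      # NRthenR? + (# NRthenNR? + # NRthen0?)   ≡⟨ #NQR≡#NRthenR+#NRthenNR+#NRthen0 ⟨
      # NQR?                                    ≡⟨ #NQR≡w+w ⟩
      w + w                                     ∎)
      where
      open ≡.≡-Reasoning
      #NRthen0≡0 : # NRthen0? ≡ 0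
      #NRthen0≡0 = #-∅ (λ x p → minus-one-not-NQR (NQR-resp (NRthen0-minus-one p) (proj₁ p))) NRthen0?

    NQR-succ-nonzero : ∀ {β} → NQR F β → ¬ β +ᶠ 1# ≈ 0#
    NQR-succ-nonzero nqr-β β+1≈0 = minus-one-not-NQR (NQR-resp (NRthen0-minus-one (nqr-β , β+1≈0)) nqr-β)

    Witness : Carrier → Set (c ⊔ ℓ)
    Witness β = NQR F β × NQR F ((β +ᶠ 1#) *ᶠ (β -ᶠ 1#))

    Witness? : Decidable Witness
    Witness? β = NQR? β ×-dec NQR? ((β +ᶠ 1#) *ᶠ (β -ᶠ 1#))

    Witness-resp : Witness Respects _≈_
    Witness-resp β≈γ (nqr-β , nqr-P) = NQR-resp β≈γ nqr-β , NQR-resp (*-cong (+-congʳ β≈γ) (+-congʳ β≈γ)) nqr-P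

    -- If there were no witness, the consecutive nonresidues would be invariant under x ↦ x + 1,
    -- so w = #NRthenNR would vanish in F.
    module NoWitness (none : ∀ β → ¬ Witness β) where
      product-QR : ∀ {β} → NQR F β → ¬ β -ᶠ 1# ≈ 0# → QR F ((β +ᶠ 1#) *ᶠ (β -ᶠ 1#))
      product-QR {β} nqr-β β-1≉0 =
        [ (λ qr → qr) , (λ nqr → ⊥-elim (none β (nqr-β , nqr))) ]′
          (QR-or-NQR (*-nonzero (NQR-succ-nonzero nqr-β) β-1≉0))

      pred-succ : ∀ x → (x +ᶠ 1#) -ᶠ 1# ≈ x
      pred-succ = Permutation.unapply-apply translation

      pred-succ-nonzero : ∀ {x} → ¬ x ≈ 0# → ¬ (x +ᶠ 1#) -ᶠ 1# ≈ 0#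
      pred-succ-nonzero {x} x≉0 eq = x≉0 (trans (sym (pred-succ x)) eq)

      -- With β = x + 1: β - 1 = x ∈ NQR and (β + 1)(β - 1) ∈ QR force β + 1 ∈ NQR.
      up : ∀ x → NRthenNR x → NRthenNR (x +ᶠ 1#)
      up x (nqr-x , nqr-x+1) =
        nqr-x+1 , NQR-partner (QR-resp (*-comm _ _) (product-QR nqr-x+1 (pred-succ-nonzero (proj₁ nqr-x))))
                              (NQR-resp (sym (pred-succ x)) nqr-x) (NQR-succ-nonzero nqr-x+1)

      -- With β = x + 1: β + 1 ∈ NQR and (β + 1)(β - 1) ∈ QR force x = β - 1 ∈ NQR
      -- (x ≠ 0 because x + 1 ∈ NQR while 1 ∈ QR).
      down : ∀ x → NRthenNR (x +ᶠ 1#) → NRthenNR x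
      down x (nqr-x+1 , nqr-x+2) =
        NQR-resp (pred-succ x) (NQR-partner (product-QR nqr-x+1 β-1≉0) nqr-x+2 β-1≉0) , nqr-x+1
        where
        x≉0 : ¬ x ≈ 0#
        x≉0 x≈0 = proj₂ nqr-x+1 (QR-resp (sym (trans (+-congʳ x≈0) (+-identityˡ 1#))) 1-QR)
        β-1≉0 : ¬ (x +ᶠ 1#) -ᶠ 1# ≈ 0#
        β-1≉0 = pred-succ-nonzero x≉0

      ⟦w⟧≈0 : ⟦ w ⟧ ≈ 0#
      ⟦w⟧≈0 = ≡.subst (λ n → ⟦ n ⟧ ≈ 0#) #NRthenNR≡w (translation-invariant-count NRthenNR-resp up down NRthenNR?)

    -- Since q = 4·w + 1, w does not vanish in F, so a witness exists.
    consecutive-nonresidues : ∃ Witness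
    consecutive-nonresidues with search Witness-resp Witness?
    ... | yes found = found
    ... | no ¬found = ⊥-elim (⟦m⟧≉0 0≉1 4 w q≡4w+1 (NoWitness.⟦w⟧≈0 (λ β wβ → ¬found (β , wβ))))

-- For k ≥ 2, q = 2^k·t + 1 = 4·(2^(k-2)·t) + 1, so OneModFour applies.
mainTheorem4 : ∀ {c ℓ : Level} (q k t : ℕ) → IsPrimePower q → q ≡ 2 ^ k * t + 1 → 1 < k → 1 < t → (Σ ℕ λ m → t ≡ 2 * m + 1) →
    (F : CommutativeRing c ℓ) → IsField F → HasCardinality F q →
    ∃ λ β → NQR F β × NQR F (CommutativeRing._*_ F (CommutativeRing._+_ F β (CommutativeRing.1# F)) (CommutativeRing._-_ F β (CommutativeRing.1# F)))
mainTheorem4 q (suc (suc k)) t _ q≡2^k·t+1 _ _ _ F isField card =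
  FiniteField.OneModFour.consecutive-nonresidues F isField card (2 ^ k * t)
    (≡.trans q≡2^k·t+1 (≡.cong (_+ 1) (regroup (2 ^ k) t)))
  where
  regroup : ∀ x t → 2 * (2 * x) * t ≡ 4 * (x * t)
  regroup = solve-∀
mainTheorem4 q (suc zero) t _ _ (s≤s ()) _ _ F isField card
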